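{- Let $\mathcal{M}=\langle X,\mathcal{T},i\rangle$ be a topological model. Then there exists a family $\{\mathcal{F}^\psi\}_{\psi\in\mathcal{L}}$ of finite stable splittings such that: (1) for every formula $\psi$, $\mathcal{F}^\psi\subseteq\mathcal{F}^\circ_{\mathcal{M}}$ and $X\in\mathcal{F}^\psi$; (2) for every formula $\psi$, if $U\in\mathcal{F}^\psi$ then $U^\psi:=\{x\in U : x,U\models\psi\}\in\mathcal{F}_{\mathcal{M}}$; (3) if $\phi$ is a subformula of $\psi$ then $\mathcal{F}^\phi\subseteq\mathcal{F}^\psi$ and $\mathcal{F}^\psi$ is a finite stable splitting for $\phi$.
   Context: Language $\mathcal{L}$: fix a countable set $\mathsf{A}$ of atomic formulas containing $\top,\bot$; formulas are built from atomic formulas by $\land,\neg,\Box,\mathsf{K}$. A topological model is a triple $\langle X,\mathcal{T},i\rangle$ where $\mathcal{T}$ is a topology on $X$ (its members are called opens) and $i:\mathsf{A}\to\mathcal{P}(X)$ with $i(\top)=X$, $i(\bot)=\emptyset$. Satisfaction is defined for pairs $(x,U)$ with $U\in\mathcal{T}$, $x\in U$: $x,U\models A$ iff $x\in i(A)$; Boolean connectives as usual; $x,U\models\mathsf{K}\phi$ iff $y,U\models\phi$ for all $y\in U$; $x,U\models\Box\phi$ iff $x,V\models\phi$ for all $V\in\mathcal{T}$ with $V\subseteq U$ and $x\in V$. For $U\in\mathcal{T}$ let ${\downarrow}U=\{V\in\mathcal{T}: V\subseteq U\}$. For a finite family $\mathcal{F}=\{U_1,\dots,U_n\}$ of opens,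 the remainder of $U_k$ is $\mathrm{Rem}_{\mathcal{F}}(U_k)={\downarrow}U_k-\bigcup_{U_k\not\subseteq U_i}{\downarrow}U_i$. A finite splitting is a finite family of opens closed under (pairwise) intersection; its remainders partition $\bigcup_{U\in\mathcal{F}}{\downarrow}U$. A set $\mathcal{G}$ of opens is stable for $\phi$ if for every $x$, either $x,V\models\phi$ for all $V\in\mathcal{G}$ with $x\in V$, or $x,V\models\neg\phi$ for all $V\in\mathcal{G}$ with $x\in V$. A finite splitting $\mathcal{F}$ is a (finite) stable splitting for $\phi$ if $\mathrm{Rem}_{\mathcal{F}}(U)$ is stable for $\phi$ for every $U\in\mathcal{F}$. $\mathcal{F}_{\mathcal{M}}$ is the least family of subsets of $X$ containing $\{i(A): A\in\mathsf{A}\}$ and closed under complement (relative to $X$), binary intersection and topological interior $S\mapsto S^\circ$; $\mathcal{F}^\circ_{\mathcal{M}}=\{S^\circ : S\in\mathcal{F}_{\mathcal{M}}\}$ $(=\mathcal{F}_{\mathcal{M}}\cap\mathcal{T})$. -}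

module Defs where

open import Level using (0ℓ)
open import Data.Nat using (ℕ)
open import Data.Empty using (⊥)
open import Data.Unit using (⊤)
open import Data.Product using (Σ; ∃; _×_; _,_)
open import Data.Sum using (_⊎_)
open import Data.List using (List)
open import Data.List.Membership.Propositional using (_∈_)
open import Data.List.Relation.Unary.Any using (Any)
open import Relation.Nullary using (¬_)
open import Relation.Unary using (Pred; _⊆_; _≐_; _∩_; ∁)

-- Formulas of L.  The countable set A of atomic formulas is
-- {⊤, ⊥} ∪ {p n | n ∈ ℕ}; ⊤/⊥ are the constructors top/bot.
data Formula : Set where
  top bot : Formula
  atom    : ℕ → Formula
  _∧_     : Formula → Formula → Formula
  ¬'_     : Formula → Formula
  □_      : Formula → Formula
  K_      : Formula → Formula

data _≼_ : Formula → Formula → Set where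
  ≼-refl : ∀ {φ} → φ ≼ φ
  ≼-∧ˡ   : ∀ {φ ψ χ} → φ ≼ ψ → φ ≼ (ψ ∧ χ)
  ≼-∧ʳ   : ∀ {φ ψ χ} → φ ≼ χ → φ ≼ (ψ ∧ χ)
  ≼-¬    : ∀ {φ ψ} → φ ≼ ψ → φ ≼ (¬' ψ)
  ≼-□    : ∀ {φ ψ} → φ ≼ ψ → φ ≼ (□ ψ)
  ≼-K    : ∀ {φ ψ} → φ ≼ ψ → φ ≼ (K ψ)

-- Subsets of X are predicates X → Set, equal when
-- extensionally equal (_≐_).  The topology is presented by a (small)
-- index type O of opens with extension ⟦_⟧, containing X and closed
-- under binary intersection and arbitrary (Set-indexed) unions, up to ≐.
-- i(⊤)=X and i(⊥)=∅ are built into the semantics of top/bot.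
record TopModel : Set₁ where
  field
    X      : Set
    O      : Set
    ⟦_⟧    : O → Pred X 0ℓ
    val    : ℕ → Pred X 0ℓ
    open-X : Σ O λ o → ∀ x → ⟦ o ⟧ x
    open-∩ : ∀ a b → Σ O λ o → ⟦ o ⟧ ≐ (⟦ a ⟧ ∩ ⟦ b ⟧)
    open-⋃ : (I : Set) (f : I → O) →
             Σ O λ o → ⟦ o ⟧ ≐ (λ x → Σ I λ j → ⟦ f j ⟧ x)

module _ (M : TopModel) where
  open TopModel M

  -- x , U ⊨ φ   (only ever used with x ∈ ⟦U⟧)
  Sat : X → O → Formula → Set
  Sat x U top      = ⊤
  Sat x U bot      = ⊥
  Sat x U (atom n) = val n x
  Sat x U (φ ∧ ψ)  = Sat x U φ × Sat x U ψ
  Sat x U (¬' φ)   = ¬ Sat x U φ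
  Sat x U (K φ)    = ∀ y → ⟦ U ⟧ y → Sat y U φ
  Sat x U (□ φ)    = ∀ V → ⟦ V ⟧ ⊆ ⟦ U ⟧ → ⟦ V ⟧ x → Sat x V φ

  Int : Pred X 0ℓ → Pred X 0ℓ
  Int S x = Σ O λ V → ⟦ V ⟧ x × ⟦ V ⟧ ⊆ S

  data FM : Pred X 0ℓ → Set₁ where
    fm-atom : ∀ n → FM (val n)
    fm-top  : FM (λ _ → ⊤)
    fm-bot  : FM (λ _ → ⊥)
    fm-∁    : ∀ {S} → FM S → FM (∁ S)
    fm-∩    : ∀ {S T} → FM S → FM T → FM (S ∩ T)
    fm-int  : ∀ {S} → FM S → FM (Int S)
    fm-≐    : ∀ {S T} → S ≐ T → FM S → FM T

  -- membership of a subset in F_M (F_M is ≐-closed, so this is just FM)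
  InFM : Pred X 0ℓ → Set₁
  InFM P = FM P

  InFM° : O → Set₁
  InFM° U = Σ (Pred X 0ℓ) λ S → FM S × (⟦ U ⟧ ≐ Int S)

  -- finite families of opens (membership of opens up to ≐)
  _∈ᶠ_ : O → List O → Set
  U ∈ᶠ F = Any (λ V → ⟦ U ⟧ ≐ ⟦ V ⟧) F

  _⊑_ : List O → List O → Set
  F ⊑ G = ∀ U → U ∈ F → U ∈ᶠ G

  IsSplitting : List O → Set
  IsSplitting F = ∀ U V → U ∈ F → V ∈ F → Σ O λ W → W ∈ F × (⟦ W ⟧ ≐ (⟦ U ⟧ ∩ ⟦ V ⟧))

  -- Rem_F(U) = ↓U − ⋃ { ↓W | W ∈ F, U ⊄ W }, as a predicate on opens
  Rem : List O → O → Pred O 0ℓ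
  Rem F U V = (⟦ V ⟧ ⊆ ⟦ U ⟧) × (∀ W → W ∈ F → ¬ (⟦ U ⟧ ⊆ ⟦ W ⟧) → ¬ (⟦ V ⟧ ⊆ ⟦ W ⟧))

  Stable : Pred O 0ℓ → Formula → Set
  Stable G φ = ∀ x → (∀ V → G V → ⟦ V ⟧ x → Sat x V φ)
                   ⊎ (∀ V → G V → ⟦ V ⟧ x → Sat x V (¬' φ))

  StableSplitting : List O → Formula → Set
  StableSplitting F φ = IsSplitting F × (∀ U → U ∈ F → Stable (Rem F U) φ)

  Ext : O → Formula → Pred X 0ℓ
  Ext U ψ x = ⟦ U ⟧ x × Sat x U ψ

  HasX : List O → Set
  HasX F = Any (λ V → ∀ x → ⟦ V ⟧ x) F

{-# OPTIONS --safe #-}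
module Submission where

-- The splittings are built by recursion on the formula: {X} for atoms, pairwise
-- intersections for ∧, the same family for ¬, and for K φ and □ φ the family 𝓕 φ
-- refined by the opens int(C^φ), respectively int(C ⇒ W), for C, W ∈ 𝓕 φ.
-- The invariant carried along is stronger than stability: for EVERY open U (not only
-- members), truth of ψ at x is the same at U and at each V in the remainder of U.
-- Every open lies in the remainder of the least member of a splitting above it, so
-- K φ and □ φ at an arbitrary open reduce to φ at finitely many members C; the added
-- opens detect exactly when passing from U to a smaller V could change the answer,
-- and the same reduction writes U^ψ as a Boolean combination of sets of F_M.

open import Defs
open import Level using (0ℓ)
open import Axiom.ExcludedMiddle using (ExcludedMiddle)
open import Axiom.DoubleNegationElimination using (em⇒dne)
open import Data.Product using (Σ; _×_; _,_; proj₁; proj₂)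
open import Data.Sum using (inj₁; inj₂)
open import Data.Unit using (tt)
open import Data.Empty using (⊥-elim)
open import Data.List using (List; []; _∷_; map; cartesianProductWith)
open import Data.List.Membership.Propositional using (_∈_; find; lose)
open import Data.List.Membership.Propositional.Properties using (∈-map⁺; ∈-cartesianProductWith⁺; ∈-cartesianProductWith⁻)
open import Data.List.Relation.Unary.All as All using (All; []; _∷_)
open import Data.List.Relation.Unary.All.Properties using (map⁺; cartesianProductWith⁺)
open import Data.List.Relation.Unary.Any using (here; there)
open import Function using (_∘_)
open import Function.Bundles using (_⇔_; mk⇔; Equivalence)
open import Relation.Nullary using (¬_; yes; no)
open import Relation.Unary using (Pred; _⊆_; _≐_; _∩_)
open import Relation.Unary.Properties using (≐-refl; ≐-trans)
open import Relation.Binary.PropositionalEquality using (refl; setoid)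

module Construction (em : ExcludedMiddle 0ℓ) (M : TopModel) where
  open TopModel M
  open Equivalence using (to; from)

  dne : {P : Set} → ¬ ¬ P → P
  dne = em⇒dne em

  Xᵒ : O
  Xᵒ = proj₁ open-X

  ∈-Xᵒ : ∀ x → ⟦ Xᵒ ⟧ x
  ∈-Xᵒ = proj₂ open-X

  infixr 7 _⊓_
  _⊓_ : O → O → O
  U ⊓ V = proj₁ (open-∩ U V)

  ⊓-≐ : ∀ U V → ⟦ U ⊓ V ⟧ ≐ (⟦ U ⟧ ∩ ⟦ V ⟧)
  ⊓-≐ U V = proj₂ (open-∩ U V)

  ⊓-elimˡ : ∀ U V → ⟦ U ⊓ V ⟧ ⊆ ⟦ U ⟧
  ⊓-elimˡ U V = proj₁ ∘ proj₁ (⊓-≐ U V)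

  ⊓-elimʳ : ∀ U V → ⟦ U ⊓ V ⟧ ⊆ ⟦ V ⟧
  ⊓-elimʳ U V = proj₂ ∘ proj₁ (⊓-≐ U V)

  ⊓-intro : ∀ U V {x} → ⟦ U ⟧ x → ⟦ V ⟧ x → ⟦ U ⊓ V ⟧ x
  ⊓-intro U V u v = proj₂ (⊓-≐ U V) (u , v)

  interior : Pred X 0ℓ → O
  interior S = proj₁ (open-⋃ (Σ O λ V → ⟦ V ⟧ ⊆ S) proj₁)

  interior-≐ : ∀ S → ⟦ interior S ⟧ ≐ (λ x → Σ (Σ O λ V → ⟦ V ⟧ ⊆ S) λ V → ⟦ proj₁ V ⟧ x)
  interior-≐ S = proj₂ (open-⋃ (Σ O λ V → ⟦ V ⟧ ⊆ S) proj₁)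

  interior-⊆ : ∀ S → ⟦ interior S ⟧ ⊆ S
  interior-⊆ S p with proj₁ (interior-≐ S) p
  ... | (V , V⊆S) , v = V⊆S v

  interior-largest : ∀ S V → ⟦ V ⟧ ⊆ S → ⟦ V ⟧ ⊆ ⟦ interior S ⟧
  interior-largest S V V⊆S v = proj₂ (interior-≐ S) ((V , V⊆S) , v)

  infixr 6 _⇒ᵒ_
  _⇒ᵒ_ : O → O → O
  C ⇒ᵒ W = interior (λ x → ⟦ C ⟧ x → ⟦ W ⟧ x)

  ⇒ᵒ-intro : ∀ V C W → ⟦ V ⊓ C ⟧ ⊆ ⟦ W ⟧ → ⟦ V ⟧ ⊆ ⟦ C ⇒ᵒ W ⟧
  ⇒ᵒ-intro V C W V⊓C⊆W = interior-largest _ V (λ v c → V⊓C⊆W (⊓-intro V C v c))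

  ⇒ᵒ-elim : ∀ C W {x} → ⟦ C ⇒ᵒ W ⟧ x → ⟦ C ⟧ x → ⟦ W ⟧ x
  ⇒ᵒ-elim C W = interior-⊆ _

  FM-const : (P : Set) → FM M (λ _ → P)
  FM-const P with em {P}
  ... | yes p = fm-≐ ((λ _ → p) , (λ _ → tt)) fm-top
  ... | no ¬p = fm-≐ ((λ ()) , ¬p) fm-bot

  FM-⇒ : ∀ {S T} → FM M S → FM M T → FM M (λ x → S x → T x)
  FM-⇒ fS fT = fm-≐ ((λ ¬[s∧¬t] s → dne (λ ¬t → ¬[s∧¬t] (s , ¬t))) , (λ s⇒t (s , ¬t) → ¬t (s⇒t s)))
                    (fm-∁ (fm-∩ fS (fm-∁ fT)))

  FM-⋂ : {A : Set} (L : List A) {S : A → Pred X 0ℓ} →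
         (∀ {a} → a ∈ L → FM M (S a)) → FM M (λ x → ∀ a → a ∈ L → S a x)
  FM-⋂ [] _ = fm-≐ ((λ _ _ ()) , (λ _ → tt)) fm-top
  FM-⋂ (a ∷ L) {S} fS = fm-≐ (⋂-cons , (λ s → s a (here refl) , (λ b → s b ∘ there)))
                         (fm-∩ (fS (here refl)) (FM-⋂ L (fS ∘ there)))
    where
    ⋂-cons : ∀ {x} → S a x × (∀ b → b ∈ L → S b x) → ∀ b → b ∈ a ∷ L → S b x
    ⋂-cons (s , _) b (here refl) = s
    ⋂-cons (_ , s) b (there b∈L) = s b b∈L

  FM-Xᵒ : FM M ⟦ Xᵒ ⟧
  FM-Xᵒ = fm-≐ ((λ _ → ∈-Xᵒ _) , (λ _ → tt)) fm-top

  FM-⊓ : ∀ {U V} → FM M ⟦ U ⟧ → FM M ⟦ V ⟧ → FM M ⟦ U ⊓ V ⟧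
  FM-⊓ {U} {V} fU fV = fm-≐ (proj₂ (⊓-≐ U V) , proj₁ (⊓-≐ U V)) (fm-∩ fU fV)

  FM-interior : ∀ {S} → FM M S → FM M ⟦ interior S ⟧
  FM-interior {S} fS = fm-≐ (Int⊆interior , λ p → _ , p , λ {x} → interior-⊆ S {x}) (fm-int fS)
    where
    Int⊆interior : Int M S ⊆ ⟦ interior S ⟧
    Int⊆interior (V , v , V⊆S) = interior-largest S V V⊆S v

  FM⇒InFM° : ∀ {U} → FM M ⟦ U ⟧ → InFM° M U
  FM⇒InFM° {U} fU = ⟦ U ⟧ , fU , (λ u → U , u , (λ v → v)) , (λ (V , v , V⊆U) → V⊆U v)

  ∈ᶠ-⊑ : ∀ {U F G} → _∈ᶠ_ M U F → _⊑_ M F G → _∈ᶠ_ M U G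
  ∈ᶠ-⊑ U∈F F⊑G with find U∈F
  ... | V , V∈F , U≐V with find (F⊑G V V∈F)
  ...   | W , W∈G , V≐W = lose W∈G (≐-trans U≐V V≐W)

  ⊑-refl : ∀ {F} → _⊑_ M F F
  ⊑-refl U U∈F = lose U∈F ≐-refl

  ⊑-trans : ∀ {F G H} → _⊑_ M F G → _⊑_ M G H → _⊑_ M F H
  ⊑-trans F⊑G G⊑H U U∈F = ∈ᶠ-⊑ (F⊑G U U∈F) G⊑H

  Rem-antitone : ∀ {F G U V} → _⊑_ M F G → Rem M G U V → Rem M F U V
  Rem-antitone F⊑G (V⊆U , sep) = V⊆U , λ W W∈F U⊈W V⊆W →
    let W' , W'∈G , W≐W' = find (F⊑G W W∈F)
    in sep W' W'∈G (λ U⊆W' → U⊈W (proj₂ W≐W' ∘ U⊆W')) (proj₁ W≐W' ∘ V⊆W)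

  Rem-upward : ∀ {F C V V'} → Rem M F C V → ⟦ V ⟧ ⊆ ⟦ V' ⟧ → ⟦ V' ⟧ ⊆ ⟦ C ⟧ → Rem M F C V'
  Rem-upward (_ , sep) V⊆V' V'⊆C = V'⊆C , λ W W∈F C⊈W V'⊆W → sep W W∈F C⊈W (V'⊆W ∘ V⊆V')

  Rem-⊆ : ∀ {F U V W} → Rem M F U V → _∈ᶠ_ M W F → ⟦ V ⟧ ⊆ ⟦ W ⟧ → ⟦ U ⟧ ⊆ ⟦ W ⟧
  Rem-⊆ (_ , sep) W∈F V⊆W with find W∈F
  ... | W' , W'∈F , W≐W' = proj₂ W≐W' ∘ dne (λ U⊈W' → sep W' W'∈F U⊈W' (proj₁ W≐W' ∘ V⊆W))

  least-above : ∀ {F} → IsSplitting M F → HasX M F → ∀ U L → (∀ {W} → W ∈ L → W ∈ F) →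
                Σ O λ C → C ∈ F × ⟦ U ⟧ ⊆ ⟦ C ⟧ × (∀ W → W ∈ L → ⟦ U ⟧ ⊆ ⟦ W ⟧ → ⟦ C ⟧ ⊆ ⟦ W ⟧)
  least-above sF hF U [] _ =
    let C , C∈F , C-full = find hF in C , C∈F , (λ _ → C-full _) , λ _ ()
  least-above sF hF U (W ∷ L) L⊆F with least-above sF hF U L (L⊆F ∘ there) | em {⟦ U ⟧ ⊆ ⟦ W ⟧}
  ... | C , C∈F , U⊆C , least | no U⊈W = C , C∈F , U⊆C , least-∷
    where
    least-∷ : ∀ W' → W' ∈ W ∷ L → ⟦ U ⟧ ⊆ ⟦ W' ⟧ → ⟦ C ⟧ ⊆ ⟦ W' ⟧
    least-∷ _ (here refl) U⊆W = ⊥-elim (U⊈W U⊆W)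
    least-∷ W' (there W'∈L) = least W' W'∈L
  ... | C , C∈F , U⊆C , least | yes U⊆W with sF C W C∈F (L⊆F (here refl))
  ...   | C' , C'∈F , C'≐ = C' , C'∈F , (λ u → proj₂ C'≐ (U⊆C u , U⊆W u)) , least-∷
    where
    least-∷ : ∀ W' → W' ∈ W ∷ L → ⟦ U ⟧ ⊆ ⟦ W' ⟧ → ⟦ C' ⟧ ⊆ ⟦ W' ⟧
    least-∷ _ (here refl) _ = proj₂ ∘ proj₁ C'≐
    least-∷ W' (there W'∈L) U⊆W' = least W' W'∈L U⊆W' ∘ proj₁ ∘ proj₁ C'≐

  Rem-cover : ∀ {F} → IsSplitting M F → HasX M F → ∀ U → Σ O λ C → C ∈ F × Rem M F C U
  Rem-cover {F} sF hF U with least-above sF hF U F (λ W∈F → W∈F)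
  ... | C , C∈F , U⊆C , least = C , C∈F , U⊆C , λ W W∈F C⊈W U⊆W → C⊈W (least W W∈F U⊆W)

  record IsFMSplitting (F : List O) : Set₁ where
    field
      isSplitting      : IsSplitting M F
      hasX             : HasX M F
      definableMembers : All (FM M ∘ ⟦_⟧) F
  open IsFMSplitting public

  [_]-isSplitting : ∀ U → IsSplitting M (U ∷ [])
  [ U ]-isSplitting _ _ (here refl) (here refl) = U , here refl , (λ u → u , u) , proj₁

  Xᵒ∷-isSplitting : ∀ {F} → IsSplitting M F → IsSplitting M (Xᵒ ∷ F)
  Xᵒ∷-isSplitting sF _ _ (here refl)  (here refl)  = Xᵒ , here refl , (λ u → u , u) , proj₁
  Xᵒ∷-isSplitting sF _ V (here refl)  (there V∈F) = V , there V∈F , (λ v → ∈-Xᵒ _ , v) , proj₂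
  Xᵒ∷-isSplitting sF U _ (there U∈F) (here refl)  = U , there U∈F , (λ u → u , ∈-Xᵒ _) , proj₁
  Xᵒ∷-isSplitting sF U V (there U∈F) (there V∈F) =
    let W , W∈F , W≐ = sF U V U∈F V∈F in W , there W∈F , W≐

  Xᵒ∷-IsFMSplitting : ∀ {F} → IsSplitting M F → All (FM M ∘ ⟦_⟧) F → IsFMSplitting (Xᵒ ∷ F)
  Xᵒ∷-IsFMSplitting sF dF = record
    { isSplitting      = Xᵒ∷-isSplitting sF
    ; hasX             = here ∈-Xᵒ
    ; definableMembers = FM-Xᵒ ∷ dF
    }

  Xᵒ-only : IsFMSplitting (Xᵒ ∷ [])
  Xᵒ-only = Xᵒ∷-IsFMSplitting (λ _ _ ()) []

  Xᵒ-and : ∀ {U} → FM M ⟦ U ⟧ → IsFMSplitting (Xᵒ ∷ U ∷ [])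
  Xᵒ-and {U} fU = Xᵒ∷-IsFMSplitting [ U ]-isSplitting (fU ∷ [])

  infixl 6 _⊗_
  _⊗_ : List O → List O → List O
  _⊗_ = cartesianProductWith _⊓_

  ⊗-isSplitting : ∀ {F G} → IsSplitting M F → IsSplitting M G → IsSplitting M (F ⊗ G)
  ⊗-isSplitting {F} {G} sF sG P Q P∈ Q∈
    with ∈-cartesianProductWith⁻ _⊓_ F G P∈ | ∈-cartesianProductWith⁻ _⊓_ F G Q∈
  ... | U , V , U∈ , V∈ , refl | U' , V' , U'∈ , V'∈ , refl
    with sF U U' U∈ U'∈ | sG V V' V∈ V'∈
  ... | A , A∈ , A≐ | B , B∈ , B≐ = A ⊓ B , ∈-cartesianProductWith⁺ _⊓_ A∈ B∈ , ⊆-∩ , ∩-⊆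
    where
    ⊆-∩ : ⟦ A ⊓ B ⟧ ⊆ ⟦ U ⊓ V ⟧ ∩ ⟦ U' ⊓ V' ⟧
    ⊆-∩ p with proj₁ A≐ (⊓-elimˡ A B p) | proj₁ B≐ (⊓-elimʳ A B p)
    ... | u , u' | v , v' = ⊓-intro U V u v , ⊓-intro U' V' u' v'
    ∩-⊆ : ⟦ U ⊓ V ⟧ ∩ ⟦ U' ⊓ V' ⟧ ⊆ ⟦ A ⊓ B ⟧
    ∩-⊆ (p , q) = ⊓-intro A B (proj₂ A≐ (⊓-elimˡ U V p , ⊓-elimˡ U' V' q))
                              (proj₂ B≐ (⊓-elimʳ U V p , ⊓-elimʳ U' V' q))

  ⊗-hasX : ∀ {F G} → HasX M F → HasX M G → HasX M (F ⊗ G)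
  ⊗-hasX hF hG with find hF | find hG
  ... | U , U∈ , U-full | V , V∈ , V-full =
    lose (∈-cartesianProductWith⁺ _⊓_ U∈ V∈) (λ x → ⊓-intro U V (U-full x) (V-full x))

  ⊗-IsFMSplitting : ∀ {F G} → IsFMSplitting F → IsFMSplitting G → IsFMSplitting (F ⊗ G)
  ⊗-IsFMSplitting {F} {G} sF sG = record
    { isSplitting      = ⊗-isSplitting (isSplitting sF) (isSplitting sG)
    ; hasX             = ⊗-hasX (hasX sF) (hasX sG)
    ; definableMembers = cartesianProductWith⁺ (setoid O) (setoid O) _⊓_ F G
        (λ U∈ V∈ → FM-⊓ (All.lookup (definableMembers sF) U∈) (All.lookup (definableMembers sG) V∈))
    }

  ⊑-⊗ˡ : ∀ {F G} → HasX M G → _⊑_ M F (F ⊗ G)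
  ⊑-⊗ˡ hG U U∈F with find hG
  ... | V , V∈G , V-full =
    lose (∈-cartesianProductWith⁺ _⊓_ U∈F V∈G) ((λ u → ⊓-intro U V u (V-full _)) , ⊓-elimˡ U V)

  ⊑-⊗ʳ : ∀ {F G} → HasX M F → _⊑_ M G (F ⊗ G)
  ⊑-⊗ʳ hF V V∈G with find hF
  ... | U , U∈F , U-full =
    lose (∈-cartesianProductWith⁺ _⊓_ U∈F V∈G) ((λ v → ⊓-intro U V (U-full _) v) , ⊓-elimʳ U V)

  adjoin : List O → List O → List O
  adjoin []      F = F
  adjoin (U ∷ L) F = adjoin L F ⊗ (Xᵒ ∷ U ∷ [])

  adjoin-IsFMSplitting : ∀ {F} L → All (FM M ∘ ⟦_⟧) L → IsFMSplitting F → IsFMSplitting (adjoin L F)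
  adjoin-IsFMSplitting []      []        sF = sF
  adjoin-IsFMSplitting (U ∷ L) (fU ∷ dL) sF = ⊗-IsFMSplitting (adjoin-IsFMSplitting L dL sF) (Xᵒ-and fU)

  adjoin-hasX : ∀ {F} L → HasX M F → HasX M (adjoin L F)
  adjoin-hasX []      hF = hF
  adjoin-hasX (U ∷ L) hF = ⊗-hasX (adjoin-hasX L hF) (here ∈-Xᵒ)

  ⊑-adjoin : ∀ {F} L → _⊑_ M F (adjoin L F)
  ⊑-adjoin []      = ⊑-refl
  ⊑-adjoin (U ∷ L) = ⊑-trans (⊑-adjoin L) (⊑-⊗ˡ (here ∈-Xᵒ))

  ∈-adjoin : ∀ {F U} L → HasX M F → U ∈ L → _∈ᶠ_ M U (adjoin L F)
  ∈-adjoin (U ∷ L) hF (here refl) = ⊑-⊗ʳ (adjoin-hasX L hF) U (there (here refl))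
  ∈-adjoin (_ ∷ L) hF (there U∈L) = ∈ᶠ-⊑ (∈-adjoin L hF U∈L) (⊑-⊗ˡ (here ∈-Xᵒ))

  record Coherent (F : List O) (ψ : Formula) : Set where
    field
      agree : ∀ U V {x} → Rem M F U V → ⟦ V ⟧ x → Sat M x V ψ ⇔ Sat M x U ψ
  open Coherent public

  coherent-mono : ∀ {F G ψ} → Coherent F ψ → _⊑_ M F G → Coherent G ψ
  coherent-mono c F⊑G .agree U V r = agree c U V (Rem-antitone F⊑G r)

  coherent⇒stable : ∀ {F ψ} → Coherent F ψ → ∀ U → Stable M (Rem M F U) ψ
  coherent⇒stable {ψ = ψ} c U x with em {Sat M x U ψ}
  ... | yes s = inj₁ λ V r v → from (agree c U V r v) s
  ... | no ¬s = inj₂ λ V r v s → ¬s (to (agree c U V r v) s)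

  coherent⇒stableSplitting : ∀ {F ψ} → IsSplitting M F → Coherent F ψ → StableSplitting M F ψ
  coherent⇒stableSplitting sF c = sF , λ U _ → coherent⇒stable c U

  open-independent⇒coherent : ∀ {F ψ} → (∀ {x U V} → Sat M x U ψ → Sat M x V ψ) → Coherent F ψ
  open-independent⇒coherent indep .agree _ _ _ _ = mk⇔ indep indep

  ∧-coherent : ∀ {F φ ψ} → Coherent F φ → Coherent F ψ → Coherent F (φ ∧ ψ)
  ∧-coherent cφ cψ .agree U V r v =
    mk⇔ (λ (s , t) → to (agree cφ U V r v) s , to (agree cψ U V r v) t)
        (λ (s , t) → from (agree cφ U V r v) s , from (agree cψ U V r v) t)

  ¬-coherent : ∀ {F φ} → Coherent F φ → Coherent F (¬' φ)
  ¬-coherent c .agree U V r v =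
    mk⇔ (λ ¬s s → ¬s (from (agree c U V r v) s)) (λ ¬s s → ¬s (to (agree c U V r v) s))

  K-coherent : ∀ {G F φ} → IsSplitting M G → HasX M G → Coherent G φ → _⊑_ M G F →
               (∀ {C} → C ∈ G → _∈ᶠ_ M (interior (Ext M C φ)) F) → Coherent F (K φ)
  K-coherent {G} {F} {φ} sG hG cG G⊑F int∈F .agree U V {x} r@(V⊆U , _) _ = mk⇔ V⇒U U⇒V
    where
    rG : Rem M G U V
    rG = Rem-antitone G⊑F r
    U⇒V : Sat M x U (K φ) → Sat M x V (K φ)
    U⇒V sU y v = from (agree cG U V rG v) (sU y (V⊆U v))
    V⇒U : Sat M x V (K φ) → Sat M x U (K φ)
    V⇒U sV with Rem-cover sG hG U
    ... | C , C∈G , rC@(U⊆C , _) = λ y u → from (agree cG C U rC u) (proj₂ (interior-⊆ _ (U⊆int u)))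
      where
      V⊆Ext : ⟦ V ⟧ ⊆ Ext M C φ
      V⊆Ext {y} v = U⊆C (V⊆U v) , to (agree cG C U rC (V⊆U v)) (to (agree cG U V rG v) (sV y v))
      U⊆int : ⟦ U ⟧ ⊆ ⟦ interior (Ext M C φ) ⟧
      U⊆int = Rem-⊆ r (int∈F C∈G) (interior-largest _ V V⊆Ext)

  □-coherent : ∀ {G F φ} → IsSplitting M G → HasX M G → Coherent G φ →
               (∀ {C W} → C ∈ G → W ∈ G → _∈ᶠ_ M (C ⇒ᵒ W) F) → Coherent F (□ φ)
  □-coherent {G} {F} {φ} sG hG cG ⇒∈F .agree U V {x} r@(V⊆U , _) v = mk⇔ V⇒U U⇒V
    where
    U⇒V : Sat M x U (□ φ) → Sat M x V (□ φ)
    U⇒V sU V' V'⊆V = sU V' (V⊆U ∘ V'⊆V)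
    V⇒U : Sat M x V (□ φ) → Sat M x U (□ φ)
    V⇒U sV V' V'⊆U v' with Rem-cover sG hG V'
    ... | C , C∈G , rC@(V'⊆C , sepC) =
      from (agree cG C V' rC v') (to (agree cG C (V ⊓ C) rV⊓C x∈V⊓C) (sV (V ⊓ C) (⊓-elimˡ V C) x∈V⊓C))
      where
      x∈V⊓C : ⟦ V ⊓ C ⟧ x
      x∈V⊓C = ⊓-intro V C v (V'⊆C v')
      rV⊓C : Rem M G C (V ⊓ C)
      rV⊓C = ⊓-elimʳ V C , λ W W∈G C⊈W V⊓C⊆W →
        let U⊆C⇒W = Rem-⊆ r (⇒∈F C∈G W∈G) (⇒ᵒ-intro V C W V⊓C⊆W)
        in sepC W W∈G C⊈W (λ w → ⇒ᵒ-elim C W (U⊆C⇒W (V'⊆U w)) (V'⊆C w))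

  record Definable (ψ : Formula) : Set₁ where
    field
      FM-Ext : ∀ U → FM M ⟦ U ⟧ → FM M (Ext M U ψ)
  open Definable public

  ∧-definable : ∀ {φ ψ} → Definable φ → Definable ψ → Definable (φ ∧ ψ)
  ∧-definable dφ dψ .FM-Ext U fU =
    fm-≐ ((λ ((u , s) , (_ , t)) → u , s , t) , (λ (u , s , t) → (u , s) , (u , t)))
         (fm-∩ (FM-Ext dφ U fU) (FM-Ext dψ U fU))

  ¬-definable : ∀ {φ} → Definable φ → Definable (¬' φ)
  ¬-definable dφ .FM-Ext U fU =
    fm-≐ ((λ (u , ¬us) → u , λ s → ¬us (u , s)) , (λ (u , ¬s) → u , ¬s ∘ proj₂))
         (fm-∩ fU (fm-∁ (FM-Ext dφ U fU)))

  K-definable : ∀ {φ} → Definable (K φ)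
  K-definable .FM-Ext U fU = fm-∩ fU (FM-const _)

  -- x , U ⊨ □ φ  iff  x , C ⊨ φ for every C ∈ G containing x whose remainder contains U ⊓ C.
  □-definable : ∀ {G φ} → IsFMSplitting G → Coherent G φ → Definable φ → Definable (□ φ)
  □-definable {G} {φ} sG cG dφ .FM-Ext U fU =
    fm-≐ (⊆-Ext , Ext-⊆) (fm-∩ fU (FM-⋂ G {□-clause} λ C∈G →
      FM-⇒ (FM-const _) (FM-⇒ (member C∈G) (FM-Ext dφ _ (member C∈G)))))
    where
    member : ∀ {C} → C ∈ G → FM M ⟦ C ⟧
    member = All.lookup (definableMembers sG)
    □-clause : O → Pred X 0ℓ
    □-clause C x = Rem M G C (U ⊓ C) → ⟦ C ⟧ x → Ext M C φ x
    Ext-⊆ : Ext M U (□ φ) ⊆ ⟦ U ⟧ ∩ (λ x → ∀ C → C ∈ G → □-clause C x)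
    Ext-⊆ (u , sU) = u , λ C _ r c →
      c , to (agree cG C (U ⊓ C) r (⊓-intro U C u c)) (sU (U ⊓ C) (⊓-elimˡ U C) (⊓-intro U C u c))
    ⊆-Ext : ⟦ U ⟧ ∩ (λ x → ∀ C → C ∈ G → □-clause C x) ⊆ Ext M U (□ φ)
    ⊆-Ext (u , clauses) = u , λ V' V'⊆U v' →
      let C , C∈G , rC@(V'⊆C , _) = Rem-cover (isSplitting sG) (hasX sG) V'
          rU⊓C = Rem-upward rC (λ w → ⊓-intro U C (V'⊆U w) (V'⊆C w)) (⊓-elimʳ U C)
      in from (agree cG C V' rC v') (proj₂ (clauses C C∈G rU⊓C (V'⊆C v')))

  implications : List O → List O
  implications F = cartesianProductWith _⇒ᵒ_ F F

  truthInteriors : Formula → List O → List O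
  truthInteriors φ = map (λ C → interior (Ext M C φ))

  implications-definable : ∀ {G} → All (FM M ∘ ⟦_⟧) G → All (FM M ∘ ⟦_⟧) (implications G)
  implications-definable {G} dG = cartesianProductWith⁺ (setoid O) (setoid O) _⇒ᵒ_ G G
    λ C∈G W∈G → FM-interior (FM-⇒ (All.lookup dG C∈G) (All.lookup dG W∈G))

  truthInteriors-definable : ∀ {φ G} → Definable φ → All (FM M ∘ ⟦_⟧) G → All (FM M ∘ ⟦_⟧) (truthInteriors φ G)
  truthInteriors-definable dφ dG = map⁺ (All.map (λ {C} fC → FM-interior (FM-Ext dφ C fC)) dG)

  𝓕 : Formula → List O
  𝓕 top      = Xᵒ ∷ []
  𝓕 bot      = Xᵒ ∷ []
  𝓕 (atom n) = Xᵒ ∷ []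
  𝓕 (φ ∧ ψ)  = 𝓕 φ ⊗ 𝓕 ψ
  𝓕 (¬' φ)   = 𝓕 φ
  𝓕 (□ φ)    = adjoin (implications (𝓕 φ)) (𝓕 φ)
  𝓕 (K φ)    = adjoin (truthInteriors φ (𝓕 φ)) (𝓕 φ)

  record Adequate (ψ : Formula) : Set₁ where
    field
      fmSplitting : IsFMSplitting (𝓕 ψ)
      coherent    : Coherent (𝓕 ψ) ψ
      definable   : Definable ψ
  open Adequate public

  adequate : ∀ ψ → Adequate ψ
  adequate top = record
    { fmSplitting = Xᵒ-only
    ; coherent    = open-independent⇒coherent (λ s → s)
    ; definable   = record { FM-Ext = λ U fU → fm-∩ fU fm-top }
    }
  adequate bot = record
    { fmSplitting = Xᵒ-only
    ; coherent    = open-independent⇒coherent (λ s → s)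
    ; definable   = record { FM-Ext = λ U fU → fm-∩ fU fm-bot }
    }
  adequate (atom n) = record
    { fmSplitting = Xᵒ-only
    ; coherent    = open-independent⇒coherent (λ s → s)
    ; definable   = record { FM-Ext = λ U fU → fm-∩ fU (fm-atom n) }
    }
  adequate (φ ∧ ψ) = record
    { fmSplitting = ⊗-IsFMSplitting sφ sψ
    ; coherent    = ∧-coherent (coherent-mono (coherent aφ) (⊑-⊗ˡ (hasX sψ)))
                               (coherent-mono (coherent aψ) (⊑-⊗ʳ (hasX sφ)))
    ; definable   = ∧-definable (definable aφ) (definable aψ)
    }
    where
    aφ = adequate φ
    aψ = adequate ψ
    sφ = fmSplitting aφ
    sψ = fmSplitting aψ
  adequate (¬' φ) = record
    { fmSplitting = fmSplitting a
    ; coherent    = ¬-coherent (coherent a)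
    ; definable   = ¬-definable (definable a)
    }
    where a = adequate φ
  adequate (□ φ) = record
    { fmSplitting = adjoin-IsFMSplitting L (implications-definable (definableMembers s)) s
    ; coherent    = □-coherent (isSplitting s) (hasX s) (coherent a)
                               (λ C∈G W∈G → ∈-adjoin L (hasX s) (∈-cartesianProductWith⁺ _⇒ᵒ_ C∈G W∈G))
    ; definable   = □-definable s (coherent a) (definable a)
    }
    where
    a = adequate φ
    s = fmSplitting a
    L = implications (𝓕 φ)
  adequate (K φ) = record
    { fmSplitting = adjoin-IsFMSplitting L (truthInteriors-definable (definable a) (definableMembers s)) s
    ; coherent    = K-coherent (isSplitting s) (hasX s) (coherent a) (⊑-adjoin L)
                               (λ C∈G → ∈-adjoin L (hasX s) (∈-map⁺ _ C∈G))
    ; definable   = K-definable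
    }
    where
    a = adequate φ
    s = fmSplitting a
    L = truthInteriors φ (𝓕 φ)

  𝓕-mono : ∀ {φ ψ} → φ ≼ ψ → _⊑_ M (𝓕 φ) (𝓕 ψ)
  𝓕-mono ≼-refl                = ⊑-refl
  𝓕-mono (≼-∧ˡ {χ = χ} φ≼ψ)    = ⊑-trans (𝓕-mono φ≼ψ) (⊑-⊗ˡ (hasX (fmSplitting (adequate χ))))
  𝓕-mono (≼-∧ʳ {ψ = ψ} φ≼χ)    = ⊑-trans (𝓕-mono φ≼χ) (⊑-⊗ʳ (hasX (fmSplitting (adequate ψ))))
  𝓕-mono (≼-¬ φ≼ψ)             = 𝓕-mono φ≼ψ
  𝓕-mono (≼-□ {ψ = ψ} φ≼ψ)    = ⊑-trans (𝓕-mono φ≼ψ) (⊑-adjoin (implications (𝓕 ψ)))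
  𝓕-mono (≼-K {ψ = ψ} φ≼ψ)    = ⊑-trans (𝓕-mono φ≼ψ) (⊑-adjoin (truthInteriors ψ (𝓕 ψ)))

mainTheorem2 : ExcludedMiddle 0ℓ → (M : TopModel) →
    Σ (Formula → List (TopModel.O M)) λ F →
      ((ψ : Formula) → StableSplitting M (F ψ) ψ)
      × ((ψ : Formula) → All (InFM° M) (F ψ) × HasX M (F ψ))
      × ((ψ : Formula) (U : TopModel.O M) → U ∈ F ψ → InFM M (Ext M U ψ))
      × ((φ ψ : Formula) → φ ≼ ψ → _⊑_ M (F φ) (F ψ) × StableSplitting M (F ψ) φ)
mainTheorem2 em M =
    𝓕
  , (λ ψ → coherent⇒stableSplitting (isSplitting (𝓢 ψ)) (coherent (adequate ψ)))
  , (λ ψ → All.map FM⇒InFM° (definableMembers (𝓢 ψ)) , hasX (𝓢 ψ))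
  , (λ ψ U U∈ → FM-Ext (definable (adequate ψ)) U (All.lookup (definableMembers (𝓢 ψ)) U∈))
  , (λ φ ψ φ≼ψ → 𝓕-mono φ≼ψ
               , coherent⇒stableSplitting (isSplitting (𝓢 ψ)) (coherent-mono (coherent (adequate φ)) (𝓕-mono φ≼ψ)))
  where
  open Construction em M
  𝓢 : ∀ ψ → IsFMSplitting (𝓕 ψ)
  𝓢 ψ = fmSplitting (adequate ψ)
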